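{- Let $q$ be a prime power, $n\geq1$, $1\neq\sigma\in\mathrm{Aut}(\mathbb F_q)$ with fixed field $\mathbb F_s$, and define $m(r)=\frac{q^{n+1-r}-1}{q-1}+\frac{s^r-1}{s-1}$. Then for every $r=1,\dots,n+1$, \[\max\{\theta_M: M\in M_{n+1}(q),\ \mathrm{rank}(M)=r\}\leq m(r).\]
   Context: $V^*=\mathbb F_q^{n+1}$ (row vectors), $V=\mathbb F_q^{n+1}$ (column vectors); $\xi^\sigma$ is $\xi$ with $\sigma$ applied coordinatewise. $\theta_M$ is the number of points $[\xi]\in\mathrm{PG}(V^*)$ such that $\ker(\xi^\sigma)\subseteq\ker(\xi M)$, where $\ker\eta=\{x\in V:\eta x=0\}$ (equal to $V$ if $\eta=0$); equivalently, $\xi M$ is a (possibly zero) scalar multiple of $\xi^\sigma$. -}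

module Defs where

open import Level using (0ℓ)
open import Data.Nat using (ℕ; zero; suc; _+_; _^_; _∸_; _≤_)
open import Data.Nat.Primality using (Prime)
open import Data.Fin using (Fin; zero; suc)
open import Data.List using (List; []; _∷_; map; concatMap; allFin)
open import Data.Product using (Σ; ∃; ∃-syntax; Σ-syntax; _×_; _,_)
open import Data.Vec.Functional using () renaming (_∷_ to _∷ᶠ_)
open import Function.Bundles using (_↔_; Inverse)
open import Relation.Binary.PropositionalEquality using (_≡_; _≢_)
open import Relation.Nullary using (¬_)

IsPrimePower : ℕ → Set
IsPrimePower q = ∃[ p ] ∃[ k ] (Prime p × q ≡ p ^ suc k)

record FiniteField (q : ℕ) : Set₁ where
  infixl 6 _+F_
  infixl 7 _*F_
  field
    F     : Set
    0F 1F : F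
    _+F_ _*F_ : F → F → F
    -F_   : F → F
    _⁻¹F  : F → F
    +-assoc : ∀ x y z → (x +F y) +F z ≡ x +F (y +F z)
    +-comm  : ∀ x y → x +F y ≡ y +F x
    +-idˡ   : ∀ x → 0F +F x ≡ x
    +-invˡ  : ∀ x → (-F x) +F x ≡ 0F
    *-assoc : ∀ x y z → (x *F y) *F z ≡ x *F (y *F z)
    *-comm  : ∀ x y → x *F y ≡ y *F x
    *-idˡ   : ∀ x → 1F *F x ≡ x
    distribˡ : ∀ x y z → x *F (y +F z) ≡ (x *F y) +F (x *F z)
    0≢1     : 0F ≢ 1F
    *-invˡ  : ∀ x → x ≢ 0F → (x ⁻¹F) *F x ≡ 1F
    finite  : F ↔ Fin q

  elems : List F
  elems = map (Inverse.from finite) (allFin q)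

data Count {A : Set} (P : A → Set) : List A → ℕ → Set where
  cnil  : Count P [] 0
  cyes  : ∀ {x xs t} → P x → Count P xs t → Count P (x ∷ xs) (suc t)
  cno   : ∀ {x xs t} → ¬ P x → Count P xs t → Count P (x ∷ xs) t

allVecs : {A : Set} → List A → (k : ℕ) → List (Fin k → A)
allVecs as zero    = (λ ()) ∷ []
allVecs as (suc k) = concatMap (λ a → map (λ v → a ∷ᶠ v) (allVecs as k)) as

-- q-analogue [k]_x = 1 + x + ... + x^(k-1)  ( = (x^k - 1)/(x - 1) for x ≥ 2 )
geom : ℕ → ℕ → ℕ
geom x zero    = 0
geom x (suc k) = x ^ k + geom x k

mBound : (q s n r : ℕ) → ℕ
mBound q s n r = geom q (suc n ∸ r) + geom s r

module LinAlg {q : ℕ} (𝔽 : FiniteField q) where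
  open FiniteField 𝔽

  Σᶠ : {k : ℕ} → (Fin k → F) → F
  Σᶠ {zero}  f = 0F
  Σᶠ {suc k} f = f zero +F Σᶠ (λ i → f (suc i))

  -- (n+1)×(n+1) matrices: M i j = entry in row i, column j
  Mat : ℕ → Set
  Mat n = Fin (suc n) → Fin (suc n) → F

  _⋆_ : {n : ℕ} → (Fin (suc n) → F) → Mat n → (Fin (suc n) → F)
  (ξ ⋆ M) j = Σᶠ (λ i → ξ i *F M i j)

  LinIndep : {n k : ℕ} → (Fin k → Fin (suc n) → F) → Set
  LinIndep {n} {k} v =
    (c : Fin k → F) → (∀ j → Σᶠ (λ i → c i *F v i j) ≡ 0F) → ∀ i → c i ≡ 0F

  col : {n : ℕ} → Mat n → Fin (suc n) → Fin (suc n) → F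
  col M j i = M i j

  HasRank : {n : ℕ} → Mat n → ℕ → Set
  HasRank {n} M r =
    (Σ[ f ∈ (Fin r → Fin (suc n)) ] LinIndep {n} {r} (λ a → col M (f a)))
    × (∀ (g : Fin (suc r) → Fin (suc n)) → ¬ LinIndep {n} {suc r} (λ a → col M (g a)))

  -- canonical representative of a point of PG(V*): first nonzero coordinate is 1
  data Normalized : {k : ℕ} → (Fin k → F) → Set where
    lead : ∀ {k} {ξ : Fin (suc k) → F} → ξ zero ≡ 1F → Normalized ξ
    skip : ∀ {k} {ξ : Fin (suc k) → F} → ξ zero ≡ 0F
         → Normalized (λ i → ξ (suc i)) → Normalized ξ

  -- ker(ξ^σ) ⊆ ker(ξ M), equivalently ξ M is a scalar multiple of ξ^σ
  SemilinCond : {n : ℕ} → (F → F) → Mat n → (Fin (suc n) → F) → Set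
  SemilinCond σ M ξ = ∃[ c ] (∀ j → (ξ ⋆ M) j ≡ c *F σ (ξ j))

  -- θ_M = t : the number of points [ξ] of PG(V*) with ξ M ∈ F·ξ^σ is t
  Theta : {n : ℕ} → (F → F) → Mat n → ℕ → Set
  Theta {n} σ M t =
    Count (λ ξ → Normalized ξ × SemilinCond σ M ξ) (allVecs elems (suc n)) t

  record IsAutomorphism (σ : F → F) : Set where
    field
      σ-bij : F ↔ F
      σ-fun : ∀ x → Inverse.to σ-bij x ≡ σ x
      σ-+   : ∀ x y → σ (x +F y) ≡ σ x +F σ y
      σ-*   : ∀ x y → σ (x *F y) ≡ σ x *F σ y
      σ-1   : σ 1F ≡ 1F

-- A point [ξ] with ξ M = c ξ^σ either has c = 0, so that ξ annihilates r independent
-- columns of M and [ξ] ranges over a projective space of dimension n − r, or has c ≠ 0.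
-- Points of the second kind are counted by induction on r, for any linear ψ and any linear
-- ρ into F^r with ker ρ ⊆ ker ψ (here ψ ξ = ξ M and ρ pairs ξ with the independent columns).
-- Given such a point [v], projecting from [v], and projecting images from [v^σ], yields
-- maps ψ̄, ρ̄ of the same kind with rank r − 1, under which the other points go to points
-- of ψ̄. On each line through [v] the parameters l of points differ by solutions of
-- δ a = c δ^σ, which form a one-dimensional F_s-subspace of F_q, so each fibre holds at
-- most s points and the count is at most 1 + s (s^(r−1) − 1)/(s − 1) = (s^r − 1)/(s − 1).
-- "At most b points" is encoded as an index into Fin b shared only by proportional vectors.

module Submission where

open import Defs
open import Level using (0ℓ)
open import Algebra.Bundles using (CommutativeRing)
open import Algebra.Consequences.Propositional using (comm∧idˡ⇒id; comm∧invˡ⇒inv; comm∧distrˡ⇒distrʳ)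
open import Data.Nat as ℕ using (ℕ; zero; suc; _+_; _*_; _∸_; _≤_; _^_)
import Data.Nat.Properties as ℕ
open import Data.Fin as Fin using (Fin; zero; suc; punchIn; combine; remQuot; join; splitAt)
import Data.Fin.Properties as Fin
open import Data.Product using (Σ; ∃; ∃₂; ∃-syntax; _×_; _,_; proj₁; proj₂)
open import Data.Sum using (_⊎_; inj₁; inj₂)
open import Data.Sum.Properties using (inj₁-injective; inj₂-injective)
open import Data.List using (List; []; _∷_; _++_; map; concatMap; cartesianProductWith)
open import Data.List.Membership.Propositional using (_∈_)
open import Data.List.Membership.Propositional.Properties using (∈-map⁺; ∈-allFin)
open import Data.List.Relation.Unary.All as All using ([])
open import Data.List.Relation.Unary.AllPairs using ([]; _∷_)
open import Data.List.Relation.Unary.Any using (here; there)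
import Data.List.Relation.Unary.Unique.Setoid as UniqueSetoid
import Data.List.Relation.Unary.Unique.Setoid.Properties as UniqueSetoid
import Data.List.Relation.Unary.Unique.Propositional.Properties as UniquePropositional
open import Relation.Binary.Bundles using (Setoid)
open import Data.Vec.Functional using (Vector; removeAt; insertAt) renaming (_∷_ to _∷ᶠ_)
open import Data.Vec.Functional.Properties using (insertAt-lookup; insertAt-punchIn; removeAt-punchOut; removeAt-insertAt)
open import Function using (_∘_)
open import Function.Bundles using (Inverse; Injection)
open import Function.Properties.Inverse using (↔⇒↣)
open import Relation.Binary.Definitions using (DecidableEquality)
open import Relation.Binary.PropositionalEquality
  using (_≡_; _≢_; refl; sym; trans; cong; cong₂; subst; setoid; isEquivalence; module ≡-Reasoning)
open import Relation.Nullary using (¬_; Dec; yes; no; contradiction)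
open import Relation.Nullary.Decidable using (¬?; _×-dec_; map′; via-injection; decidable-stable)
open import Relation.Unary using (Pred; _⊆_; _∪_; Empty)

module Counting where

  count-covering : {A : Set} {P : A → Set} {xs : List A} {t : ℕ} → Count P xs t →
                   Σ (Fin t → A) λ sel → ∀ {x} → x ∈ xs → P x → ∃ λ i → sel i ≡ x
  count-covering cnil = (λ ()) , λ ()
  count-covering (cyes {x = y} py c) with count-covering c
  ... | sel , covers = (y ∷ᶠ sel) , λ where
    (here refl) _   → zero , refl
    (there x∈xs) px → let i , selᵢ≡x = covers x∈xs px in suc i , selᵢ≡x
  count-covering (cno ¬py c) with count-covering c
  ... | sel , covers = sel , λ where
    (here refl) py  → contradiction py ¬py
    (there x∈xs) px → covers x∈xs px

  module _ (S : Setoid 0ℓ 0ℓ) {P : Setoid.Carrier S → Set} where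
    open Setoid S using (_≈_) renaming (Carrier to A; sym to ≈-sym)

    count-selection : {xs : List A} {t : ℕ} → Count P xs t → UniqueSetoid.Unique S xs →
                      Σ (Fin t → A) λ sel → (∀ i → P (sel i)) × (∀ i → sel i ∈ xs) × (∀ i j → sel i ≈ sel j → i ≡ j)
    count-selection cnil [] = (λ ()) , (λ ()) , (λ ()) , λ ()
    count-selection (cyes {x = y} py c) (y∉ys ∷ ys!) with count-selection c ys!
    ... | sel , P-sel , sel∈ , sel-injective = (y ∷ᶠ sel) , P-sel′ , sel∈′ , sel-injective′
      where
      P-sel′ : ∀ i → P ((y ∷ᶠ sel) i)
      P-sel′ zero    = py
      P-sel′ (suc i) = P-sel i
      sel∈′ : ∀ i → (y ∷ᶠ sel) i ∈ y ∷ _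
      sel∈′ zero    = here refl
      sel∈′ (suc i) = there (sel∈ i)
      sel-injective′ : ∀ i j → (y ∷ᶠ sel) i ≈ (y ∷ᶠ sel) j → i ≡ j
      sel-injective′ zero    zero    _ = refl
      sel-injective′ zero    (suc j) e = contradiction e (All.lookup y∉ys (sel∈ j))
      sel-injective′ (suc i) zero    e = contradiction (≈-sym e) (All.lookup y∉ys (sel∈ i))
      sel-injective′ (suc i) (suc j) e = cong suc (sel-injective i j e)
    count-selection (cno _ c) (_ ∷ ys!) with count-selection c ys!
    ... | sel , P-sel , sel∈ , sel-injective = sel , P-sel , there ∘ sel∈ , sel-injective

join-injective : ∀ m n {i j : Fin m ⊎ Fin n} → join m n i ≡ join m n j → i ≡ j
join-injective m n {i} {j} e = trans (sym (Fin.splitAt-join m n i)) (trans (cong (splitAt m) e) (Fin.splitAt-join m n j))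

concatMap-map≡cartesianProductWith : {A B C : Set} (f : A → B → C) (xs : List A) (ys : List B) →
                                     concatMap (λ x → map (f x) ys) xs ≡ cartesianProductWith f xs ys
concatMap-map≡cartesianProductWith f []       ys = refl
concatMap-map≡cartesianProductWith f (x ∷ xs) ys = cong (map (f x) ys ++_) (concatMap-map≡cartesianProductWith f xs ys)

geom-suc : ∀ x r → geom x (suc r) ≡ suc (geom x r * x)
geom-suc x zero    = refl
geom-suc x (suc r) = begin
  x ^ suc r + geom x (suc r)        ≡⟨ cong (x ^ suc r +_) (geom-suc x r) ⟩
  x ^ suc r + suc (geom x r * x)    ≡⟨ ℕ.+-suc _ _ ⟩
  suc (x * x ^ r + geom x r * x)    ≡⟨ cong (λ y → suc (y + geom x r * x)) (ℕ.*-comm x (x ^ r)) ⟩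
  suc (x ^ r * x + geom x r * x)    ≡⟨ cong suc (ℕ.*-distribʳ-+ x (x ^ r) (geom x r)) ⟨
  suc ((x ^ r + geom x r) * x)      ∎
  where open ≡-Reasoning

module FieldProperties {q : ℕ} (𝔽 : FiniteField q) where
  open FiniteField 𝔽

  commutativeRing : CommutativeRing 0ℓ 0ℓ
  commutativeRing = record
    { Carrier = F ; _≈_ = _≡_ ; _+_ = _+F_ ; _*_ = _*F_ ; -_ = -F_ ; 0# = 0F ; 1# = 1F
    ; isCommutativeRing = record
      { isRing = record
        { +-isAbelianGroup = record
          { isGroup = record
            { isMonoid = record
              { isSemigroup = record
                { isMagma = record { isEquivalence = isEquivalence ; ∙-cong = cong₂ _+F_ }
                ; assoc = +-assoc }
              ; identity = comm∧idˡ⇒id +-comm +-idˡ }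
            ; inverse = comm∧invˡ⇒inv +-comm +-invˡ
            ; ⁻¹-cong = cong -F_ }
          ; comm = +-comm }
        ; *-cong = cong₂ _*F_
        ; *-assoc = *-assoc
        ; *-identity = comm∧idˡ⇒id *-comm *-idˡ
        ; distrib = distribˡ , comm∧distrˡ⇒distrʳ *-comm distribˡ }
      ; *-comm = *-comm } }

  open CommutativeRing commutativeRing public
    using (_-_; ring; semiring; +-identityʳ; *-identityʳ; -‿inverseʳ; distribʳ; zeroˡ; zeroʳ;
           +-commutativeSemigroup; *-commutativeSemigroup)
  open import Algebra.Properties.Ring ring public
    using (x[y-z]≈xy-xz; [y-z]x≈yx-zx; x+x≈x⇒x≈0; -1*x≈-x;
           -0#≈0#; -‿+-comm; +-inverseˡ-unique; x∙y⁻¹≈ε⇒x≈y; +-cancelʳ; //-rightDividesˡ)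

  open import Algebra.Properties.CommutativeSemigroup *-commutativeSemigroup public
    using (x∙yz≈y∙xz)
  open import Algebra.Properties.CommutativeSemigroup +-commutativeSemigroup public
    using (interchange)

  infix 4 _≟_
  _≟_ : DecidableEquality F
  _≟_ = via-injection (↔⇒↣ finite) Fin._≟_

  1≢0 : 1F ≢ 0F
  1≢0 = 0≢1 ∘ sym

  *-inverseʳ : ∀ x → x ≢ 0F → x *F x ⁻¹F ≡ 1F
  *-inverseʳ x x≢0 = trans (*-comm x _) (*-invˡ x x≢0)

  x⁻¹*[x*y]≡y : ∀ {x} y → x ≢ 0F → x ⁻¹F *F (x *F y) ≡ y
  x⁻¹*[x*y]≡y {x} y x≢0 = trans (sym (*-assoc _ x y)) (trans (cong (_*F y) (*-invˡ x x≢0)) (*-idˡ y))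

  x*[x⁻¹*y]≡y : ∀ {x} y → x ≢ 0F → x *F (x ⁻¹F *F y) ≡ y
  x*[x⁻¹*y]≡y {x} y x≢0 = trans (sym (*-assoc x _ y)) (trans (cong (_*F y) (*-inverseʳ x x≢0)) (*-idˡ y))

  x*y⁻¹*y≡x : ∀ x {y} → y ≢ 0F → x *F y ⁻¹F *F y ≡ x
  x*y⁻¹*y≡x x {y} y≢0 = trans (*-assoc x _ y) (trans (cong (x *F_) (*-invˡ y y≢0)) (*-identityʳ x))

  *-cancelˡ : ∀ a {x y} → a ≢ 0F → a *F x ≡ a *F y → x ≡ y
  *-cancelˡ a {x} {y} a≢0 ax≡ay =
    trans (sym (x⁻¹*[x*y]≡y x a≢0)) (trans (cong (a ⁻¹F *F_) ax≡ay) (x⁻¹*[x*y]≡y y a≢0))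

  *-cancelʳ : ∀ a {x y} → a ≢ 0F → x *F a ≡ y *F a → x ≡ y
  *-cancelʳ a {x} {y} a≢0 xa≡ya = *-cancelˡ a a≢0 (trans (*-comm a x) (trans xa≡ya (*-comm y a)))

  x-0≡x : ∀ x → x - 0F ≡ x
  x-0≡x x = trans (cong (x +F_) -0#≈0#) (+-identityʳ x)

  x*y≡0⇒y≡0 : ∀ {x y} → x ≢ 0F → x *F y ≡ 0F → y ≡ 0F
  x*y≡0⇒y≡0 {x} x≢0 xy≡0 = *-cancelˡ x x≢0 (trans xy≡0 (sym (zeroʳ x)))

  x*y≢0 : ∀ {x y} → x ≢ 0F → y ≢ 0F → x *F y ≢ 0F
  x*y≢0 x≢0 y≢0 = y≢0 ∘ x*y≡0⇒y≡0 x≢0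

  x⁻¹≢0 : ∀ {x} → x ≢ 0F → x ⁻¹F ≢ 0F
  x⁻¹≢0 {x} x≢0 x⁻¹≡0 = 1≢0 (trans (sym (*-invˡ x x≢0)) (trans (cong (_*F x) x⁻¹≡0) (zeroˡ x)))

  [x+y]-[z+w]≡[x-z]+[y-w] : ∀ x y z w → (x +F y) - (z +F w) ≡ (x - z) +F (y - w)
  [x+y]-[z+w]≡[x-z]+[y-w] x y z w =
    trans (cong ((x +F y) +F_) (sym (-‿+-comm z w))) (interchange x y (-F z) (-F w))

module Vectors {q : ℕ} (𝔽 : FiniteField q) where
  open FiniteField 𝔽
  open FieldProperties 𝔽
  open import Algebra.Properties.Semiring.Sum semiring public
    using (sum; sum-cong-≗; sum-replicate-zero; sum-remove; ∑-distrib-+; ∑-comm; *-distribˡ-sum; *-distribʳ-sum)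
  open import Data.Vec.Functional.Relation.Binary.Equality.Setoid (setoid F) public
    using (_≋_; ≋-refl; ≋-sym; ≋-trans)
  open ≡-Reasoning

  V : ℕ → Set
  V = Vector F

  private variable
    M N r : ℕ

  0ᵛ : V N
  0ᵛ _ = 0F

  infixl 6 _+ᵛ_ _-ᵛ_
  infixr 7 _·_

  _+ᵛ_ _-ᵛ_ : V N → V N → V N
  (x +ᵛ y) i = x i +F y i
  (x -ᵛ y) i = x i - y i

  _·_ : F → V N → V N
  (c · x) i = c *F x i

  Ker : (V M → V N) → Pred (V M) 0ℓ
  Ker f x = f x ≋ 0ᵛ

  Nonzero : V N → Set
  Nonzero x = ¬ x ≋ 0ᵛ

  nonzero? : (x : V N) → Dec (Nonzero x)
  nonzero? x = ¬? (Fin.all? λ i → x i ≟ 0F)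

  nonzero-coordinate : {x : V N} → Nonzero x → ∃ λ i → x i ≢ 0F
  nonzero-coordinate {x = x} = Fin.¬∀⟶∃¬ _ _ (λ i → x i ≟ 0F)

  ¬nonzero⇒≋0 : {x : V N} → ¬ Nonzero x → x ≋ 0ᵛ
  ¬nonzero⇒≋0 {x = x} = decidable-stable (Fin.all? λ i → x i ≟ 0F)

  Σᶠ≡sum : ∀ {k} (f : Fin k → F) → LinAlg.Σᶠ 𝔽 f ≡ sum f
  Σᶠ≡sum {zero}  f = refl
  Σᶠ≡sum {suc k} f = cong (f zero +F_) (Σᶠ≡sum (f ∘ suc))

  sum-zero : ∀ {k} {f : Fin k → F} → (∀ i → f i ≡ 0F) → sum f ≡ 0F
  sum-zero {k} f≡0 = trans (sum-cong-≗ f≡0) (sum-replicate-zero k)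

  dot : V N → V N → F
  dot x y = sum (λ i → x i *F y i)

  lincomb : (Fin r → F) → (Fin r → V N) → V N
  lincomb c u j = sum (λ a → c a *F u a j)

  dot-cong : {x x′ y y′ : V N} → x ≋ x′ → y ≋ y′ → dot x y ≡ dot x′ y′
  dot-cong x≋x′ y≋y′ = sum-cong-≗ (λ i → cong₂ _*F_ (x≋x′ i) (y≋y′ i))

  dot-comm : (x y : V N) → dot x y ≡ dot y x
  dot-comm x y = sum-cong-≗ (λ i → *-comm (x i) (y i))

  dot-removeAt : ∀ (k : Fin (suc N)) x y → dot x y ≡ x k *F y k +F dot (removeAt x k) (removeAt y k)
  dot-removeAt k x y = sum-remove {i = k} (λ i → x i *F y i)

  dot-+ˡ : (x y z : V N) → dot (x +ᵛ y) z ≡ dot x z +F dot y z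
  dot-+ˡ x y z = trans (sum-cong-≗ (λ i → distribʳ (z i) (x i) (y i))) (∑-distrib-+ (λ i → x i *F z i) (λ i → y i *F z i))

  dot-·ˡ : ∀ c (x y : V N) → dot (c · x) y ≡ c *F dot x y
  dot-·ˡ c x y = trans (sum-cong-≗ (λ i → *-assoc c (x i) (y i))) (sym (*-distribˡ-sum c (λ i → x i *F y i)))

  dot-lincomb : ∀ (x : V N) (c : Fin r → F) u → dot x (lincomb c u) ≡ sum (λ a → c a *F dot x (u a))
  dot-lincomb {N} {r} x c u = begin
    sum (λ i → x i *F sum (λ a → c a *F u a i))       ≡⟨ sum-cong-≗ {N} (λ i → *-distribˡ-sum (x i) (λ a → c a *F u a i)) ⟩
    sum (λ i → sum (λ a → x i *F (c a *F u a i)))     ≡⟨ ∑-comm (λ i a → x i *F (c a *F u a i)) ⟩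
    sum (λ a → sum (λ i → x i *F (c a *F u a i)))     ≡⟨ sum-cong-≗ {r} (λ a → sum-cong-≗ {N} (λ i → x∙yz≈y∙xz (x i) (c a) _)) ⟩
    sum (λ a → sum (λ i → c a *F (x i *F u a i)))     ≡⟨ sum-cong-≗ {r} (λ a → *-distribˡ-sum (c a) (λ i → x i *F u a i)) ⟨
    sum (λ a → c a *F dot x (u a))                    ∎

  dot-zeroˡ : {x : V N} (y : V N) → x ≋ 0ᵛ → dot x y ≡ 0F
  dot-zeroˡ y x≋0 = sum-zero (λ i → trans (cong (_*F y i) (x≋0 i)) (zeroˡ (y i)))

  dot-zeroʳ : (x : V N) {y : V N} → y ≋ 0ᵛ → dot x y ≡ 0F
  dot-zeroʳ x {y} y≋0 = trans (dot-comm x y) (dot-zeroˡ x y≋0)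

  dot-removeAt-zero : ∀ (k : Fin (suc N)) x {y} → y k ≡ 0F → dot (removeAt x k) (removeAt y k) ≡ dot x y
  dot-removeAt-zero k x {y} yₖ≡0 = sym (begin
    dot x y                                            ≡⟨ dot-removeAt k x y ⟩
    x k *F y k +F dot (removeAt x k) (removeAt y k)    ≡⟨ cong (λ t → x k *F t +F dot (removeAt x k) (removeAt y k)) yₖ≡0 ⟩
    x k *F 0F +F dot (removeAt x k) (removeAt y k)     ≡⟨ cong (_+F dot (removeAt x k) (removeAt y k)) (zeroʳ (x k)) ⟩
    0F +F dot (removeAt x k) (removeAt y k)            ≡⟨ +-idˡ _ ⟩
    dot (removeAt x k) (removeAt y k)                  ∎)

  dot-+·ʳ : ∀ (x y : V N) c z → dot x (y +ᵛ c · z) ≡ dot x y +F c *F dot x z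
  dot-+·ʳ x y c z = begin
    dot x (y +ᵛ c · z)          ≡⟨ dot-comm x _ ⟩
    dot (y +ᵛ c · z) x          ≡⟨ dot-+ˡ y (c · z) x ⟩
    dot y x +F dot (c · z) x    ≡⟨ cong₂ _+F_ (dot-comm y x) (trans (dot-·ˡ c z x) (cong (c *F_) (dot-comm z x))) ⟩
    dot x y +F c *F dot x z     ∎

  lincomb-+· : ∀ (c : Fin r → F) (u : Fin r → V N) (s : Fin r → F) (p : V N) →
               lincomb c (λ a → u a +ᵛ s a · p) ≋ lincomb c u +ᵛ sum (λ a → c a *F s a) · p
  lincomb-+· {r} c u s p j = begin
    sum (λ a → c a *F (u a j +F s a *F p j))                  ≡⟨ sum-cong-≗ {r} (λ a → distribˡ (c a) _ _) ⟩
    sum (λ a → c a *F u a j +F c a *F (s a *F p j))           ≡⟨ ∑-distrib-+ (λ a → c a *F u a j) (λ a → c a *F (s a *F p j)) ⟩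
    lincomb c u j +F sum (λ a → c a *F (s a *F p j))          ≡⟨ cong (lincomb c u j +F_) (sum-cong-≗ {r} (λ a → *-assoc (c a) (s a) (p j))) ⟨
    lincomb c u j +F sum (λ a → c a *F s a *F p j)            ≡⟨ cong (lincomb c u j +F_) (*-distribʳ-sum (p j) (λ a → c a *F s a)) ⟨
    lincomb c u j +F sum (λ a → c a *F s a) *F p j            ∎

  [x+l·v]-[x+l′·v]≋[l-l′]·v : ∀ (x : V N) l l′ v → (x +ᵛ l · v) -ᵛ (x +ᵛ l′ · v) ≋ (l - l′) · v
  [x+l·v]-[x+l′·v]≋[l-l′]·v x l l′ v i = begin
    (x i +F l *F v i) - (x i +F l′ *F v i)        ≡⟨ [x+y]-[z+w]≡[x-z]+[y-w] (x i) _ (x i) _ ⟩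
    (x i - x i) +F (l *F v i - l′ *F v i)         ≡⟨ cong (_+F (l *F v i - l′ *F v i)) (-‿inverseʳ (x i)) ⟩
    0F +F (l *F v i - l′ *F v i)                  ≡⟨ +-idˡ _ ⟩
    l *F v i - l′ *F v i                          ≡⟨ [y-z]x≈yx-zx (v i) l l′ ⟨
    (l - l′) *F v i                               ∎

  record Linear (f : V M → V N) : Set where
    field
      ≋-cong : {x y : V M} → x ≋ y → f x ≋ f y
      +-homo : ∀ x y → f (x +ᵛ y) ≋ f x +ᵛ f y
      ·-homo : ∀ c x → f (c · x) ≋ c · f x

    -‿homo : ∀ x y → f (x -ᵛ y) ≋ f x -ᵛ f y
    -‿homo x y i = begin
      f (x -ᵛ y) i                ≡⟨ ≋-cong (λ j → cong (x j +F_) (sym (-1*x≈-x (y j)))) i ⟩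
      f (x +ᵛ (-F 1F) · y) i      ≡⟨ +-homo x _ i ⟩
      f x i +F f ((-F 1F) · y) i  ≡⟨ cong (f x i +F_) (trans (·-homo _ y i) (-1*x≈-x _)) ⟩
      f x i - f y i               ∎

    +·-kernel : ∀ x l {v} → f v ≋ 0ᵛ → f (x +ᵛ l · v) ≋ f x
    +·-kernel x l {v} fv≋0 i = begin
      f (x +ᵛ l · v) i         ≡⟨ +-homo x (l · v) i ⟩
      f x i +F f (l · v) i     ≡⟨ cong (f x i +F_) (trans (·-homo l v i) (trans (cong (l *F_) (fv≋0 i)) (zeroʳ l))) ⟩
      f x i +F 0F              ≡⟨ +-identityʳ _ ⟩
      f x i                    ∎

    ·-‿·-homo : ∀ μ x ν y → f (μ · x -ᵛ ν · y) ≋ μ · f x -ᵛ ν · f y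
    ·-‿·-homo μ x ν y i = trans (-‿homo (μ · x) (ν · y) i) (cong₂ _-_ (·-homo μ x i) (·-homo ν y i))

  ker⊆-combination : {f : V M → V N} {g : V M → V r} → Linear f → Linear g → Ker f ⊆ Ker g →
                     ∀ μ x ν y → μ · f x ≋ ν · f y → μ · g x ≋ ν · g y
  ker⊆-combination {f = f} f-linear g-linear ker⊆ μ x ν y μfx≋νfy i =
    x∙y⁻¹≈ε⇒x≈y _ _ (trans (sym (Linear.·-‿·-homo g-linear μ x ν y i)) (ker⊆ fz≋0 i))
    where
    fz≋0 : Ker f (μ · x -ᵛ ν · y)
    fz≋0 j = trans (Linear.·-‿·-homo f-linear μ x ν y j) (trans (cong (_- (ν *F _)) (μfx≋νfy j)) (-‿inverseʳ _))

  ∘-linear : {f : V M → V N} {g : V N → V r} → Linear f → Linear g → Linear (g ∘ f)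
  ∘-linear f-lin g-lin = record
    { ≋-cong = G.≋-cong ∘ F.≋-cong
    ; +-homo = λ x y → ≋-trans (G.≋-cong (F.+-homo x y)) (G.+-homo _ _)
    ; ·-homo = λ c x → ≋-trans (G.≋-cong (F.·-homo c x)) (G.·-homo _ _)
    }
    where
    module F = Linear f-lin
    module G = Linear g-lin

  dots-linear : (u : Fin r → V N) → Linear (λ x a → dot x (u a))
  dots-linear u = record
    { ≋-cong = λ x≋y a → dot-cong x≋y ≋-refl
    ; +-homo = λ x y a → dot-+ˡ x y (u a)
    ; ·-homo = λ c x a → dot-·ˡ c x (u a)
    }

  ≋-removeAt : (k : Fin (suc N)) {x y : V (suc N)} → x k ≡ y k → removeAt x k ≋ removeAt y k → x ≋ y
  ≋-removeAt k {x} {y} xₖ≡yₖ rest i with k Fin.≟ i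
  ... | yes refl = xₖ≡yₖ
  ... | no k≢i   = trans (sym (removeAt-punchOut x k≢i)) (trans (rest _) (removeAt-punchOut y k≢i))

  -- The projection of [z] from the point [u] onto the hyperplane x_k = 0 (for u k ≢ 0),
  -- in the coordinates other than k.
  project : V (suc N) → Fin (suc N) → V (suc N) → V N
  project u k z = removeAt (u k · z -ᵛ z k · u) k

  embed : Fin (suc N) → V N → V (suc N)
  embed k w = insertAt w k 0F

  project-linear : (u : V (suc N)) (k : Fin (suc N)) → Linear (project u k)
  project-linear u k = record
    { ≋-cong = λ x≋y j → cong₂ _-_ (cong (u k *F_) (x≋y _)) (cong (_*F u _) (x≋y k))
    ; +-homo = λ x y j → trans (cong₂ _-_ (distribˡ (u k) _ _) (distribʳ _ (x k) (y k)))
                               ([x+y]-[z+w]≡[x-z]+[y-w] _ _ _ _)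
    ; ·-homo = λ c x j → trans (cong₂ _-_ (x∙yz≈y∙xz (u k) c _) (*-assoc c (x k) _))
                               (sym (x[y-z]≈xy-xz c _ _))
    }

  embed-≋ : (k : Fin (suc N)) {w : V N} {z : V (suc N)} → z k ≡ 0F → w ≋ removeAt z k → embed k w ≋ z
  embed-≋ k {w} zₖ≡0 w≋z = ≋-removeAt k (trans (insertAt-lookup w k 0F) (sym zₖ≡0))
                                        (λ j → trans (removeAt-insertAt w k 0F j) (w≋z j))

  embed-linear : (k : Fin (suc N)) → Linear (embed k)
  embed-linear k = record
    { ≋-cong = λ {x} {y} x≋y → embed-≋ k (embed-k y) (λ j → trans (x≋y j) (sym (removeAt-embed y j)))
    ; +-homo = λ x y → embed-≋ k (trans (cong₂ _+F_ (embed-k x) (embed-k y)) (+-idˡ 0F))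
                                 (λ j → sym (cong₂ _+F_ (removeAt-embed x j) (removeAt-embed y j)))
    ; ·-homo = λ c x → embed-≋ k (trans (cong (c *F_) (embed-k x)) (zeroʳ c))
                                 (λ j → sym (cong (c *F_) (removeAt-embed x j)))
    }
    where
    embed-k : ∀ w → embed k w k ≡ 0F
    embed-k w = insertAt-lookup w k 0F
    removeAt-embed : ∀ w → removeAt (embed k w) k ≋ w
    removeAt-embed w = removeAt-insertAt w k 0F

  project-self : (u : V (suc N)) (k : Fin (suc N)) → project u k u ≋ 0ᵛ
  project-self u k j = -‿inverseʳ _

  project-embed : (u : V (suc N)) (k : Fin (suc N)) (w : V N) → project u k (embed k w) ≋ u k · w
  project-embed u k w j = begin
    u k *F embed k w (punchIn k j) - embed k w k *F u (punchIn k j)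
      ≡⟨ cong₂ (λ a b → u k *F a - b *F u (punchIn k j)) (insertAt-punchIn w k 0F j) (insertAt-lookup w k 0F) ⟩
    u k *F w j - 0F *F u (punchIn k j)   ≡⟨ cong (λ b → u k *F w j - b) (zeroˡ _) ⟩
    u k *F w j - 0F                      ≡⟨ cong (u k *F w j +F_) -0#≈0# ⟩
    u k *F w j +F 0F                     ≡⟨ +-identityʳ _ ⟩
    u k *F w j                           ∎

  embed-project : (u : V (suc N)) (k : Fin (suc N)) (z : V (suc N)) → embed k (project u k z) ≋ u k · z -ᵛ z k · u
  embed-project u k z = embed-≋ k (trans (cong (u k *F z k +F_) (cong -F_ (*-comm (z k) (u k)))) (-‿inverseʳ _))
                                  (λ j → refl)

  project≋0 : (u : V (suc N)) (k : Fin (suc N)) {z : V (suc N)} → project u k z ≋ 0ᵛ → u k · z ≋ z k · u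
  project≋0 u k z≡0 = ≋-removeAt k (*-comm (u k) _) (λ j → x∙y⁻¹≈ε⇒x≈y _ _ (z≡0 j))

module AutomorphismProperties {q : ℕ} (𝔽 : FiniteField q) (σ : FiniteField.F 𝔽 → FiniteField.F 𝔽)
                              (σ-automorphism : LinAlg.IsAutomorphism 𝔽 σ) where
  open FiniteField 𝔽
  open FieldProperties 𝔽
  open Vectors 𝔽
  open LinAlg.IsAutomorphism σ-automorphism

  private variable
    N : ℕ

  σ-0 : σ 0F ≡ 0F
  σ-0 = x+x≈x⇒x≈0 _ (trans (sym (σ-+ 0F 0F)) (cong σ (+-idˡ 0F)))

  σ-injective : ∀ {x y} → σ x ≡ σ y → x ≡ y
  σ-injective {x} {y} σx≡σy = Injection.injective (↔⇒↣ σ-bij) (trans (σ-fun x) (trans σx≡σy (sym (σ-fun y))))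

  σ≢0 : ∀ {x} → x ≢ 0F → σ x ≢ 0F
  σ≢0 x≢0 σx≡0 = x≢0 (σ-injective (trans σx≡0 (sym σ-0)))

  σ-neg : ∀ x → σ (-F x) ≡ -F σ x
  σ-neg x = +-inverseˡ-unique _ _ (trans (sym (σ-+ (-F x) x)) (trans (cong σ (+-invˡ x)) σ-0))

  σ-sub : ∀ x y → σ (x - y) ≡ σ x - σ y
  σ-sub x y = trans (σ-+ x (-F y)) (cong (σ x +F_) (σ-neg y))

  σ⃗ : V N → V N
  σ⃗ x i = σ (x i)

  σ⃗-project : (u : V (suc N)) (k : Fin (suc N)) (z : V (suc N)) → σ⃗ (project u k z) ≋ project (σ⃗ u) k (σ⃗ z)
  σ⃗-project u k z j = trans (σ-sub _ _) (cong₂ _-_ (σ-* _ _) (σ-* _ _))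

module Enumeration {q : ℕ} (𝔽 : FiniteField q) where
  open FiniteField 𝔽
  open Vectors 𝔽
  open Inverse finite using (to; from; strictlyInverseˡ; strictlyInverseʳ)
  open import Data.Vec.Functional.Relation.Binary.Equality.Setoid (setoid F) using (≋-setoid)

  private variable
    N : ℕ

  encode : V N → Fin (q ^ N)
  encode {zero}  x = zero
  encode {suc N} x = combine (to (x zero)) (encode (x ∘ suc))

  decode : Fin (q ^ N) → V N
  decode {zero}  i = λ ()
  decode {suc N} i = from (proj₁ (remQuot {q} (q ^ N) i)) ∷ᶠ decode (proj₂ (remQuot {q} (q ^ N) i))

  decode-encode : (x : V N) → decode (encode x) ≋ x
  decode-encode {suc N} x zero    = trans (cong (from ∘ proj₁) (Fin.remQuot-combine {k = q ^ N} (to (x zero)) _))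
                                          (strictlyInverseʳ (x zero))
  decode-encode {suc N} x (suc j) = trans (cong (λ p → decode (proj₂ p) j) (Fin.remQuot-combine {k = q ^ N} (to (x zero)) _))
                                          (decode-encode (x ∘ suc) j)

  encode-cong : {x y : V N} → x ≋ y → encode x ≡ encode y
  encode-cong {zero}  _   = refl
  encode-cong {suc N} x≋y = cong₂ combine (cong to (x≋y zero)) (encode-cong (x≋y ∘ suc))

  encode-injective : {x y : V N} → encode x ≡ encode y → x ≋ y
  encode-injective {x = x} {y} e i =
    trans (sym (decode-encode x i)) (trans (cong (λ c → decode c i) e) (decode-encode y i))

  canonical : V N → V N
  canonical = decode ∘ encode

  canonical-≋ : (x : V N) → canonical x ≋ x
  canonical-≋ = decode-encode

  canonical-cong : {x y : V N} → x ≋ y → canonical x ≡ canonical y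
  canonical-cong = cong decode ∘ encode-cong

  elems-complete : ∀ x → x ∈ elems
  elems-complete x = subst (_∈ elems) (strictlyInverseʳ x) (∈-map⁺ from (∈-allFin (to x)))

  ∃ᶠ? : {P : F → Set} → (∀ x → Dec (P x)) → Dec (∃ P)
  ∃ᶠ? {P} P? = map′ (λ (i , p) → from i , p) (λ (x , p) → to x , subst P (sym (strictlyInverseʳ x)) p)
                     (Fin.any? (P? ∘ from))

  ∃ᵛ? : {P : V N → Set} → (∀ {x y} → x ≋ y → P x → P y) → (∀ x → Dec (P x)) → Dec (∃ P)
  ∃ᵛ? resp P? = map′ (λ (i , p) → decode i , p) (λ (x , p) → encode x , resp (≋-sym (decode-encode x)) p)
                     (Fin.any? (P? ∘ decode))

  elems-unique : UniqueSetoid.Unique (setoid F) elems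
  elems-unique = UniquePropositional.map⁺ from-injective (UniquePropositional.allFin⁺ q)
    where
    from-injective : ∀ {i j} → from i ≡ from j → i ≡ j
    from-injective {i} {j} e = trans (sym (strictlyInverseˡ i)) (trans (cong to e) (strictlyInverseˡ j))

  allVecs-unique : ∀ N → UniqueSetoid.Unique (≋-setoid N) (allVecs elems N)
  allVecs-unique zero    = [] ∷ []
  allVecs-unique (suc N) =
    subst (UniqueSetoid.Unique (≋-setoid (suc N))) (sym (concatMap-map≡cartesianProductWith _∷ᶠ_ elems (allVecs elems N)))
          (UniqueSetoid.cartesianProductWith⁺ (setoid F) (≋-setoid N) (≋-setoid (suc N)) _∷ᶠ_ (λ e → e zero , e ∘ suc)
                                              elems-unique (allVecs-unique N))

module Points {q : ℕ} (𝔽 : FiniteField q) where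
  open FiniteField 𝔽
  open FieldProperties 𝔽
  open Vectors 𝔽
  open Enumeration 𝔽
  open LinAlg 𝔽 using (Normalized; lead; skip)
  open import Data.Vec.Functional.Relation.Binary.Equality.Setoid (setoid F) using (≋-setoid)

  private variable
    M N b c : ℕ

  infix 4 _∼_
  _∼_ : V N → V N → Set
  x ∼ y = ∃ λ κ → κ ≢ 0F × x ≋ κ · y

  ≋⇒∼ : {x y : V N} → x ≋ y → x ∼ y
  ≋⇒∼ x≋y = 1F , 1≢0 , λ i → trans (x≋y i) (sym (*-idˡ _))

  ∼-sym : {x y : V N} → x ∼ y → y ∼ x
  ∼-sym {x = x} {y} (κ , κ≢0 , x≋κy) =
    κ ⁻¹F , x⁻¹≢0 κ≢0 , λ i → trans (sym (x⁻¹*[x*y]≡y (y i) κ≢0)) (cong (κ ⁻¹F *F_) (sym (x≋κy i)))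

  ∼-trans : {x y z : V N} → x ∼ y → y ∼ z → x ∼ z
  ∼-trans (κ , κ≢0 , x≋κy) (μ , μ≢0 , y≋μz) =
    κ *F μ , x*y≢0 κ≢0 μ≢0 , λ i → trans (x≋κy i) (trans (cong (κ *F_) (y≋μz i)) (sym (*-assoc κ μ _)))

  nonzero-∼ : {x y : V N} → x ∼ y → Nonzero x → Nonzero y
  nonzero-∼ (κ , _ , x≋κy) x≢0 y≋0 = x≢0 λ i → trans (x≋κy i) (trans (cong (κ *F_) (y≋0 i)) (zeroʳ κ))

  scaled-∼ : ∀ {μ ν} {x y : V N} → μ ≢ 0F → ν ≢ 0F → μ · x ≋ ν · y → x ∼ y
  scaled-∼ {μ = μ} {ν} {x} {y} μ≢0 ν≢0 μx≋νy = μ ⁻¹F *F ν , x*y≢0 (x⁻¹≢0 μ≢0) ν≢0 , λ i → begin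
    x i                    ≡⟨ x⁻¹*[x*y]≡y (x i) μ≢0 ⟨
    μ ⁻¹F *F (μ *F x i)    ≡⟨ cong (μ ⁻¹F *F_) (μx≋νy i) ⟩
    μ ⁻¹F *F (ν *F y i)    ≡⟨ *-assoc _ ν (y i) ⟨
    μ ⁻¹F *F ν *F y i      ∎
    where open ≡-Reasoning

  normalized-nonzero : {x : V N} → Normalized x → Nonzero x
  normalized-nonzero (lead x₀≡1)  x≋0 = 1≢0 (trans (sym x₀≡1) (x≋0 zero))
  normalized-nonzero (skip _ tail) x≋0 = normalized-nonzero tail (x≋0 ∘ suc)

  normalized-unique : {x y : V N} → Normalized x → Normalized y → x ∼ y → x ≋ y
  normalized-unique {y = y} (lead x₀≡1) (lead y₀≡1) (κ , _ , x≋κy) i =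
    trans (x≋κy i) (trans (cong (_*F y i) κ≡1) (*-idˡ _))
    where
    κ≡1 : κ ≡ 1F
    κ≡1 = trans (sym (*-identityʳ κ)) (trans (cong (κ *F_) (sym y₀≡1)) (trans (sym (x≋κy zero)) x₀≡1))
  normalized-unique (lead x₀≡1) (skip y₀≡0 _) (κ , _ , x≋κy) =
    contradiction (trans (sym x₀≡1) (trans (x≋κy zero) (trans (cong (κ *F_) y₀≡0) (zeroʳ κ)))) 1≢0
  normalized-unique (skip x₀≡0 _) (lead y₀≡1) (κ , κ≢0 , x≋κy) =
    contradiction (trans (sym (*-identityʳ κ)) (trans (cong (κ *F_) (sym y₀≡1)) (trans (sym (x≋κy zero)) x₀≡0))) κ≢0
  normalized-unique (skip x₀≡0 x-tail) (skip y₀≡0 y-tail) (κ , κ≢0 , x≋κy) = λ where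
    zero    → trans x₀≡0 (sym y₀≡0)
    (suc i) → normalized-unique x-tail y-tail (κ , κ≢0 , x≋κy ∘ suc) i

  normalize : (x : V N) → Nonzero x → Σ (V N) λ w → Normalized w × x ∼ w
  normalize {zero}  x x≢0 = contradiction (λ ()) x≢0
  normalize {suc N} x x≢0 with x zero ≟ 0F
  ... | no x₀≢0 = x zero ⁻¹F · x , lead (*-invˡ _ x₀≢0) , x zero , x₀≢0 , λ i → sym (x*[x⁻¹*y]≡y (x i) x₀≢0)
  ... | yes x₀≡0 with normalize (x ∘ suc) (λ tail≋0 → x≢0 λ { zero → x₀≡0 ; (suc i) → tail≋0 i })
  ...   | w , w-normalized , κ , κ≢0 , tail≋κw =
    0F ∷ᶠ w , skip refl w-normalized , κ , κ≢0 , λ { zero → trans x₀≡0 (sym (zeroʳ κ)) ; (suc i) → tail≋κw i }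

  pointIndex : (x : V N) → Normalized x → Fin (geom q N)
  pointIndex x (lead _)      = join _ _ (inj₁ (encode (x ∘ suc)))
  pointIndex x (skip _ tail) = join _ _ (inj₂ (pointIndex (x ∘ suc) tail))

  pointIndex-injective : {x y : V N} (nx : Normalized x) (ny : Normalized y) →
                         pointIndex x nx ≡ pointIndex y ny → x ≋ y
  pointIndex-injective {suc N} (lead x₀≡1) (lead y₀≡1) e = λ where
    zero    → trans x₀≡1 (sym y₀≡1)
    (suc i) → encode-injective (inj₁-injective (join-injective (q ^ N) (geom q N) e)) i
  pointIndex-injective {suc N} {x} {y} (lead _) (skip _ y-tail) e =
    contradiction (join-injective _ _ {inj₁ (encode (x ∘ suc))} {inj₂ (pointIndex (y ∘ suc) y-tail)} e) λ ()
  pointIndex-injective {suc N} {x} {y} (skip _ x-tail) (lead _) e =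
    contradiction (join-injective _ _ {inj₂ (pointIndex (x ∘ suc) x-tail)} {inj₁ (encode (y ∘ suc))} e) λ ()
  pointIndex-injective {suc N} (skip x₀≡0 x-tail) (skip y₀≡0 y-tail) e = λ where
    zero    → trans x₀≡0 (sym y₀≡0)
    (suc i) → pointIndex-injective x-tail y-tail (inj₂-injective (join-injective (q ^ N) (geom q N) e)) i

  record AtMostPoints (b : ℕ) (Q : Pred (V N) 0ℓ) : Set where
    field
      index           : ∀ x → Q x → Fin b
      index-injective : ∀ {x y} (qx : Q x) (qy : Q y) → index x qx ≡ index y qy → x ∼ y

  nonzero-atMost : AtMostPoints {N} (geom q N) Nonzero
  nonzero-atMost = record
    { index           = λ x x≢0 → let w , w-normalized , _ = normalize x x≢0 in pointIndex w w-normalized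
    ; index-injective = λ {x} {y} x≢0 y≢0 e →
        let w , w-normalized , x∼w = normalize x x≢0
            w′ , w′-normalized , y∼w′ = normalize y y≢0
        in ∼-trans x∼w (∼-trans (≋⇒∼ (pointIndex-injective w-normalized w′-normalized e)) (∼-sym y∼w′))
    }

  atMost-⊆ : {Q Q′ : Pred (V N) 0ℓ} → Q ⊆ Q′ → AtMostPoints b Q′ → AtMostPoints b Q
  atMost-⊆ Q⊆Q′ A = record
    { index           = λ x qx → index x (Q⊆Q′ qx)
    ; index-injective = λ qx qy → index-injective (Q⊆Q′ qx) (Q⊆Q′ qy)
    }
    where open AtMostPoints A

  atMost-empty : {Q : Pred (V N) 0ℓ} → Empty Q → AtMostPoints b Q
  atMost-empty ∅ = record
    { index           = λ x qx → contradiction qx (∅ x)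
    ; index-injective = λ qx → contradiction qx (∅ _)
    }

  atMost-point : (v : V N) → AtMostPoints 1 (_∼ v)
  atMost-point v = record
    { index           = λ _ _ → zero
    ; index-injective = λ x∼v y∼v _ → ∼-trans x∼v (∼-sym y∼v)
    }

  atMost-∪ : {Q Q₁ Q₂ : Pred (V N) 0ℓ} → AtMostPoints b Q₁ → AtMostPoints c Q₂ → Q ⊆ Q₁ ∪ Q₂ →
             AtMostPoints (b + c) Q
  atMost-∪ {b = b} {c} {Q₁ = Q₁} {Q₂} A₁ A₂ split = record
    { index           = λ x qx → join b c (side (split qx))
    ; index-injective = λ qx qy e → side-injective (split qx) (split qy) (join-injective b c e)
    }
    where
    module A₁ = AtMostPoints A₁
    module A₂ = AtMostPoints A₂
    side : ∀ {x} → Q₁ x ⊎ Q₂ x → Fin b ⊎ Fin c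
    side (inj₁ q₁) = inj₁ (A₁.index _ q₁)
    side (inj₂ q₂) = inj₂ (A₂.index _ q₂)
    side-injective : ∀ {x y} (sx : Q₁ x ⊎ Q₂ x) (sy : Q₁ y ⊎ Q₂ y) → side sx ≡ side sy → x ∼ y
    side-injective (inj₁ qx) (inj₁ qy) e = A₁.index-injective qx qy (inj₁-injective e)
    side-injective (inj₂ qx) (inj₂ qy) e = A₂.index-injective qx qy (inj₂-injective e)
    side-injective (inj₁ _)  (inj₂ _)  ()
    side-injective (inj₂ _)  (inj₁ _)  ()

  atMost-pullback : {Q : Pred (V M) 0ℓ} {Q′ : Pred (V N) 0ℓ} (f : V M → V N) → (∀ {x} → Q x → Q′ (f x)) →
                    (∀ {x y} → Q x → Q y → f x ∼ f y → x ∼ y) → AtMostPoints b Q′ → AtMostPoints b Q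
  atMost-pullback f f-maps f-reflects A = record
    { index           = λ x qx → index (f x) (f-maps qx)
    ; index-injective = λ qx qy e → f-reflects qx qy (index-injective (f-maps qx) (f-maps qy) e)
    }
    where open AtMostPoints A

  atMost-fibred : {Q : Pred (V M) 0ℓ} {Q′ : Pred (V N) 0ℓ} (f : V M → V N) (f-maps : ∀ {x} → Q x → Q′ (f x)) →
                  AtMostPoints b Q′ → (h : ∀ x → Q x → Fin c) →
                  (∀ {x y} (qx : Q x) (qy : Q y) → f x ∼ f y → h x qx ≡ h y qy → x ∼ y) → AtMostPoints (b * c) Q
  atMost-fibred f f-maps A h h-injective = record
    { index           = λ x qx → combine (index (f x) (f-maps qx)) (h x qx)
    ; index-injective = λ qx qy e →
        let e₁ , e₂ = Fin.combine-injective _ _ _ _ e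
        in h-injective qx qy (index-injective (f-maps qx) (f-maps qy) e₁) e₂
    }
    where open AtMostPoints A

  count≤ : {Q : Pred (V N) 0ℓ} {t : ℕ} → Count (λ ξ → Normalized ξ × Q ξ) (allVecs elems N) t →
           AtMostPoints b (λ ξ → Nonzero ξ × Q ξ) → t ≤ b
  count≤ {N = N} {b = b} {t = t} counted A with Counting.count-selection (≋-setoid N) counted (allVecs-unique N)
  ... | sel , sel-counted , _ , sel-injective = Fin.injective⇒≤ {f = selectedIndex} λ {i} {j} e →
    sel-injective i j (normalized-unique (proj₁ (sel-counted i)) (proj₁ (sel-counted j)) (index-injective _ _ e))
    where
    open AtMostPoints A
    selectedIndex : Fin t → Fin b
    selectedIndex i = let normalized , qᵢ = sel-counted i in index (sel i) (normalized-nonzero normalized , qᵢ)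

module Annihilators {q : ℕ} (𝔽 : FiniteField q) where
  open FiniteField 𝔽
  open FieldProperties 𝔽
  open Vectors 𝔽
  open Points 𝔽

  private variable
    N r : ℕ

  Independent : (Fin r → V N) → Set
  Independent u = ∀ c → lincomb c u ≋ 0ᵛ → ∀ a → c a ≡ 0F

  Annihilates : (Fin r → V N) → V N → Set
  Annihilates u ξ = ∀ a → dot ξ (u a) ≡ 0F

  independent-head : {u : Fin (suc r) → V N} → Independent u → Nonzero (u zero)
  independent-head {u = u} u-independent u₀≋0 = 1≢0 (u-independent (1F ∷ᶠ λ _ → 0F) comb≋0 zero)
    where
    comb≋0 : lincomb (1F ∷ᶠ λ _ → 0F) u ≋ 0ᵛ
    comb≋0 j = trans (cong₂ _+F_ (trans (*-idˡ _) (u₀≋0 j)) (sum-zero (λ a → zeroˡ (u (suc a) j)))) (+-idˡ 0F)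

  -- Gaussian elimination of coordinate k with the pivot u zero.
  module Elimination (u : Fin (suc r) → V (suc N)) (u-independent : Independent u) where

    p : V (suc N)
    p = u zero

    k : Fin (suc N)
    k = proj₁ (nonzero-coordinate (independent-head {u = u} u-independent))

    pₖ≢0 : p k ≢ 0F
    pₖ≢0 = proj₂ (nonzero-coordinate (independent-head {u = u} u-independent))

    shift : Fin r → F
    shift a = -F u (suc a) k *F p k ⁻¹F

    sheared : Fin r → V (suc N)
    sheared a = u (suc a) +ᵛ shift a · p

    reduced : Fin r → V N
    reduced a = removeAt (sheared a) k

    sheared-k : ∀ a → sheared a k ≡ 0F
    sheared-k a = trans (cong (u (suc a) k +F_) (x*y⁻¹*y≡x (-F u (suc a) k) pₖ≢0)) (-‿inverseʳ _)

    pivot-determined : {ζ : V (suc N)} → dot ζ p ≡ 0F → removeAt ζ k ≋ 0ᵛ → ζ ≋ 0ᵛ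
    pivot-determined {ζ} ζ·p≡0 rest≋0 = ≋-removeAt k (x*y≡0⇒y≡0 pₖ≢0 (trans (*-comm (p k) (ζ k)) ζₖpₖ≡0)) rest≋0
      where
      ζₖpₖ≡0 : ζ k *F p k ≡ 0F
      ζₖpₖ≡0 = begin
        ζ k *F p k                                        ≡⟨ +-identityʳ _ ⟨
        ζ k *F p k +F 0F                                  ≡⟨ cong (ζ k *F p k +F_) (dot-zeroˡ (removeAt p k) rest≋0) ⟨
        ζ k *F p k +F dot (removeAt ζ k) (removeAt p k)   ≡⟨ dot-removeAt k ζ p ⟨
        dot ζ p                                           ≡⟨ ζ·p≡0 ⟩
        0F                                                ∎
        where open ≡-Reasoning

    reduced-independent : Independent reduced
    reduced-independent c comb≋0 a = u-independent (sum (λ a → c a *F shift a) ∷ᶠ c) lifted≋0 (suc a)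
      where
      sheared-comb≋0 : lincomb c sheared ≋ 0ᵛ
      sheared-comb≋0 = ≋-removeAt k (sum-zero λ a → trans (cong (c a *F_) (sheared-k a)) (zeroʳ (c a))) comb≋0
      lifted≋0 : lincomb (sum (λ a → c a *F shift a) ∷ᶠ c) u ≋ 0ᵛ
      lifted≋0 j = trans (+-comm _ _) (trans (sym (lincomb-+· c (u ∘ suc) shift p j)) (sheared-comb≋0 j))

    removeAt-annihilates : {ξ : V (suc N)} → Annihilates u ξ → Annihilates reduced (removeAt ξ k)
    removeAt-annihilates {ξ} ξ-annihilates a = begin
      dot (removeAt ξ k) (reduced a)                      ≡⟨ dot-removeAt-zero k ξ {sheared a} (sheared-k a) ⟩
      dot ξ (sheared a)                                   ≡⟨ dot-+·ʳ ξ (u (suc a)) (shift a) p ⟩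
      dot ξ (u (suc a)) +F shift a *F dot ξ p             ≡⟨ cong₂ (λ x y → x +F shift a *F y) (ξ-annihilates (suc a)) (ξ-annihilates zero) ⟩
      0F +F shift a *F 0F                                 ≡⟨ trans (+-idˡ _) (zeroʳ _) ⟩
      0F                                                  ∎
      where open ≡-Reasoning

    removeAt-nonzero : {ξ : V (suc N)} → Nonzero ξ → Annihilates u ξ → Nonzero (removeAt ξ k)
    removeAt-nonzero {ξ} ξ≢0 ξ-annihilates = ξ≢0 ∘ pivot-determined {ξ} (ξ-annihilates zero)

    removeAt-reflects : {ξ η : V (suc N)} → Annihilates u ξ → Annihilates u η → removeAt ξ k ∼ removeAt η k → ξ ∼ η
    removeAt-reflects {ξ} {η} ξ-annihilates η-annihilates (κ , κ≢0 , ξ′≋κη′) =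
      κ , κ≢0 , λ i → x∙y⁻¹≈ε⇒x≈y _ _ (pivot-determined {ξ -ᵛ κ · η} ζ·p≡0 rest≋0 i)
      where
      rest≋0 : removeAt (ξ -ᵛ κ · η) k ≋ 0ᵛ
      rest≋0 j = trans (cong (_- _) (ξ′≋κη′ j)) (-‿inverseʳ _)
      ζ·p≡0 : dot (ξ -ᵛ κ · η) p ≡ 0F
      ζ·p≡0 = trans (Linear.-‿homo (dots-linear u) ξ (κ · η) zero)
                    (trans (cong₂ _-_ (ξ-annihilates zero) (trans (dot-·ˡ κ η p) (trans (cong (κ *F_) (η-annihilates zero)) (zeroʳ κ))))
                           (-‿inverseʳ 0F))

  annihilator-atMost : ∀ r {N} (u : Fin r → V N) → Independent u →
                       AtMostPoints (geom q (N ∸ r)) (λ ξ → Nonzero ξ × Annihilates u ξ)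
  annihilator-atMost zero    u _ = atMost-⊆ proj₁ nonzero-atMost
  annihilator-atMost (suc r) {zero}  u u-independent = contradiction (λ ()) (independent-head {u = u} u-independent)
  annihilator-atMost (suc r) {suc N} u u-independent =
    atMost-pullback (λ ξ → removeAt ξ k)
                    (λ {ξ} (ξ≢0 , ξ-annihilates) →
                       removeAt-nonzero {ξ} ξ≢0 ξ-annihilates , removeAt-annihilates {ξ} ξ-annihilates)
                    (λ {ξ} {η} (_ , ξ-annihilates) (_ , η-annihilates) →
                       removeAt-reflects {ξ} {η} ξ-annihilates η-annihilates)
                    (annihilator-atMost r reduced reduced-independent)
    where open Elimination u u-independent

module Matrices {q : ℕ} (𝔽 : FiniteField q) where
  open FiniteField 𝔽
  open LinAlg 𝔽 using (Mat; col; LinIndep; _⋆_)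
  open FieldProperties 𝔽
  open Vectors 𝔽
  open Enumeration 𝔽
  open Annihilators 𝔽
  open ≡-Reasoning

  private variable
    n r : ℕ

  rowTimes : Mat n → V (suc n) → V (suc n)
  rowTimes M ξ j = dot ξ (col M j)

  rowTimes-linear : (M : Mat n) → Linear (rowTimes M)
  rowTimes-linear M = dots-linear (col M)

  rowTimes≡⋆ : (M : Mat n) (ξ : V (suc n)) → rowTimes M ξ ≋ ξ ⋆ M
  rowTimes≡⋆ M ξ j = sym (Σᶠ≡sum (λ i → ξ i *F M i j))

  linIndep⇒independent : ∀ {k} {u : Fin k → V (suc n)} → LinIndep u → Independent u
  linIndep⇒independent {u = u} u-independent c comb≋0 = u-independent c λ j → trans (Σᶠ≡sum (λ a → c a *F u a j)) (comb≋0 j)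

  module _ (M : Mat n) (f : Fin r → Fin (suc n)) (f-independent : LinIndep (col M ∘ f))
           (maximal : ∀ (g : Fin (suc r) → Fin (suc n)) → ¬ LinIndep (col M ∘ g)) where

    Relation : Fin (suc n) → V (suc r) → Set
    Relation j c = lincomb c (col M ∘ (j ∷ᶠ f)) ≋ 0ᵛ × Nonzero c

    relation? : ∀ j → Dec (∃ (Relation j))
    relation? j = ∃ᵛ? relation-cong λ c → (Fin.all? λ i → lincomb c (col M ∘ (j ∷ᶠ f)) i ≟ 0F) ×-dec nonzero? c
      where
      relation-cong : ∀ {c c′} → c ≋ c′ → Relation j c → Relation j c′
      relation-cong c≋c′ (rel , c≢0) =
        (λ i → trans (sum-cong-≗ λ a → cong (_*F col M ((j ∷ᶠ f) a) i) (sym (c≋c′ a))) (rel i)) , c≢0 ∘ ≋-trans c≋c′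

    column-relation : ∀ j → ∃ λ (c : V (suc r)) → c zero ≢ 0F × lincomb c (col M ∘ (j ∷ᶠ f)) ≋ 0ᵛ
    column-relation j with relation? j
    ... | no none = contradiction independent (maximal (j ∷ᶠ f))
      where
      independent : LinIndep (col M ∘ (j ∷ᶠ f))
      independent c rel = ¬nonzero⇒≋0 λ c≢0 →
        none (c , (λ i → trans (sym (Σᶠ≡sum (λ a → c a *F col M ((j ∷ᶠ f) a) i))) (rel i)) , c≢0)
    ... | yes (c , rel , c≢0) = c , c₀≢0 , rel
      where
      rest≋0 : c zero ≡ 0F → lincomb (c ∘ suc) (col M ∘ f) ≋ 0ᵛ
      rest≋0 c₀≡0 i = begin
        lincomb (c ∘ suc) (col M ∘ f) i                          ≡⟨ +-idˡ _ ⟨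
        0F +F lincomb (c ∘ suc) (col M ∘ f) i
          ≡⟨ cong (_+F lincomb (c ∘ suc) (col M ∘ f) i) (trans (cong (_*F col M j i) c₀≡0) (zeroˡ _)) ⟨
        c zero *F col M j i +F lincomb (c ∘ suc) (col M ∘ f) i   ≡⟨ rel i ⟩
        0F                                                       ∎
      c₀≢0 : c zero ≢ 0F
      c₀≢0 c₀≡0 = c≢0 λ where
        zero    → c₀≡0
        (suc a) → linIndep⇒independent f-independent (c ∘ suc) (rest≋0 c₀≡0) a

    kernel-inclusion : Ker (λ ξ a → dot ξ (col M (f a))) ⊆ Ker (rowTimes M)
    kernel-inclusion {ξ} ξ-annihilates j = x*y≡0⇒y≡0 c₀≢0 (begin
      c zero *F dot ξ (col M j)                                       ≡⟨ +-identityʳ _ ⟨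
      c zero *F dot ξ (col M j) +F 0F                                 ≡⟨ cong (c zero *F dot ξ (col M j) +F_) rest≡0 ⟨
      sum (λ a → c a *F dot ξ (col M ((j ∷ᶠ f) a)))                   ≡⟨ dot-lincomb ξ c (col M ∘ (j ∷ᶠ f)) ⟨
      dot ξ (lincomb c (col M ∘ (j ∷ᶠ f)))                            ≡⟨ dot-zeroʳ ξ rel ⟩
      0F                                                              ∎)
      where
      c = proj₁ (column-relation j)
      c₀≢0 = proj₁ (proj₂ (column-relation j))
      rel = proj₂ (proj₂ (column-relation j))
      rest≡0 : sum (λ a → c (suc a) *F dot ξ (col M (f a))) ≡ 0F
      rest≡0 = sum-zero λ a → trans (cong (c (suc a) *F_) (ξ-annihilates a)) (zeroʳ _)

module SemilinearPoints {q : ℕ} (𝔽 : FiniteField q) (σ : FiniteField.F 𝔽 → FiniteField.F 𝔽)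
                        (σ-automorphism : LinAlg.IsAutomorphism 𝔽 σ)
                        {s : ℕ} (fixed-count : Count (λ x → σ x ≡ x) (FiniteField.elems 𝔽) s) where
  open FiniteField 𝔽
  open FieldProperties 𝔽
  open Vectors 𝔽
  open Enumeration 𝔽
  open Points 𝔽
  open AutomorphismProperties 𝔽 σ σ-automorphism
  open LinAlg.IsAutomorphism σ-automorphism using (σ-*)
  open LinAlg 𝔽 using (Mat; col; Normalized; SemilinCond)
  open Annihilators 𝔽 using (Annihilates)
  open Matrices 𝔽 using (rowTimes; rowTimes≡⋆)
  open ≡-Reasoning

  private variable
    N r b : ℕ

  fixedElement : Fin s → F
  fixedElement = proj₁ (Counting.count-covering fixed-count)

  fixedElement-covers : ∀ {x} → σ x ≡ x → ∃ λ i → fixedElement i ≡ x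
  fixedElement-covers {x} = proj₂ (Counting.count-covering fixed-count) (elems-complete x)

  fixedIndex : F → Fin s
  fixedIndex z with σ z ≟ z
  ... | yes fixed = proj₁ (fixedElement-covers fixed)
  ... | no _      = proj₁ (fixedElement-covers σ-0) -- junk: only used on σ-fixed elements

  fixedIndex-section : ∀ {z} → σ z ≡ z → fixedElement (fixedIndex z) ≡ z
  fixedIndex-section {z} fixed with σ z ≟ z
  ... | yes fixed′  = proj₂ (fixedElement-covers fixed′)
  ... | no notFixed = contradiction fixed notFixed

  fixedIndex-injective : ∀ {x y} → σ x ≡ x → σ y ≡ y → fixedIndex x ≡ fixedIndex y → x ≡ y
  fixedIndex-injective x-fixed y-fixed e =
    trans (sym (fixedIndex-section x-fixed)) (trans (cong fixedElement e) (fixedIndex-section y-fixed))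

  ratio-fixed : ∀ {a c δ ε} → c ≢ 0F → δ ≢ 0F → δ *F a ≡ c *F σ δ → ε *F a ≡ c *F σ ε →
                σ (ε *F δ ⁻¹F) ≡ ε *F δ ⁻¹F
  ratio-fixed {a} {c} {δ} {ε} c≢0 δ≢0 δa≡cσδ εa≡cσε = *-cancelˡ (σ δ) (σ≢0 δ≢0) (*-cancelˡ c c≢0 (begin
    c *F (σ δ *F σ z)     ≡⟨ cong (c *F_) (trans (*-comm (σ δ) (σ z)) (sym (σ-* z δ))) ⟩
    c *F σ (z *F δ)       ≡⟨ cong (λ t → c *F σ t) zδ≡ε ⟩
    c *F σ ε              ≡⟨ εa≡cσε ⟨
    ε *F a                ≡⟨ cong (_*F a) zδ≡ε ⟨
    z *F δ *F a           ≡⟨ *-assoc z δ a ⟩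
    z *F (δ *F a)         ≡⟨ cong (z *F_) δa≡cσδ ⟩
    z *F (c *F σ δ)       ≡⟨ x∙yz≈y∙xz z c (σ δ) ⟩
    c *F (z *F σ δ)       ≡⟨ cong (c *F_) (*-comm z (σ δ)) ⟩
    c *F (σ δ *F z)       ∎))
    where
    z = ε *F δ ⁻¹F
    zδ≡ε : z *F δ ≡ ε
    zδ≡ε = x*y⁻¹*y≡x ε δ≢0

  -- If the differences of elements of L all solve δ a = c σ δ, they form (part of) a
  -- one-dimensional F_s-subspace, so for l₀ ≢ l₁ in L the ratio (l − l₀)/(l₁ − l₀) is
  -- σ-fixed and determines l.
  module LineCoordinate (L : F → Set) (L? : ∀ l → Dec (L l)) where

    DistinctPair : Set
    DistinctPair = ∃₂ λ l₀ l₁ → L l₀ × L l₁ × l₀ ≢ l₁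

    coordinateWith : Dec DistinctPair → F → Fin s
    coordinateWith (yes (l₀ , l₁ , _)) l = fixedIndex ((l - l₀) *F (l₁ - l₀) ⁻¹F)
    coordinateWith (no _)              l = fixedIndex 0F

    distinctPair? : Dec DistinctPair
    distinctPair? = ∃ᶠ? λ l₀ → ∃ᶠ? λ l₁ → L? l₀ ×-dec L? l₁ ×-dec ¬? (l₀ ≟ l₁)

    coordinate : F → Fin s
    coordinate = coordinateWith distinctPair?

    coordinateWith-injective :
      ∀ {a} → (∀ {l₀} → L l₀ → ∃ λ c → c ≢ 0F × ∀ {l} → L l → (l - l₀) *F a ≡ c *F σ (l - l₀)) →
      (d : Dec DistinctPair) → ∀ {l l′} → L l → L l′ → coordinateWith d l ≡ coordinateWith d l′ → l ≡ l′
    coordinateWith-injective _ (no noPair) {l} {l′} Ll Ll′ _ =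
      decidable-stable (l ≟ l′) λ l≢l′ → noPair (l , l′ , Ll , Ll′ , l≢l′)
    coordinateWith-injective differences (yes (l₀ , l₁ , Ll₀ , Ll₁ , l₀≢l₁)) {l} {l′} Ll Ll′ e =
      +-cancelʳ (-F l₀) l l′ (*-cancelʳ (δ ⁻¹F) (x⁻¹≢0 δ≢0) (fixedIndex-injective (fixed Ll) (fixed Ll′) e))
      where
      δ = l₁ - l₀
      δ≢0 : δ ≢ 0F
      δ≢0 δ≡0 = l₀≢l₁ (sym (x∙y⁻¹≈ε⇒x≈y l₁ l₀ δ≡0))
      fixed : ∀ {x} → L x → σ ((x - l₀) *F δ ⁻¹F) ≡ (x - l₀) *F δ ⁻¹F
      fixed Lx = let c , c≢0 , difference = differences Ll₀ in ratio-fixed c≢0 δ≢0 (difference Ll₁) (difference Lx)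

    coordinate-injective :
      ∀ {a} → (∀ {l₀} → L l₀ → ∃ λ c → c ≢ 0F × ∀ {l} → L l → (l - l₀) *F a ≡ c *F σ (l - l₀)) →
      ∀ {l l′} → L l → L l′ → coordinate l ≡ coordinate l′ → l ≡ l′
    coordinate-injective differences = coordinateWith-injective differences distinctPair?

  SemiEigen : (V N → V N) → Pred (V N) 0ℓ
  SemiEigen ψ x = ∃ λ c → c ≢ 0F × ψ x ≋ c · σ⃗ x

  EigenPoint : (V N → V N) → Pred (V N) 0ℓ
  EigenPoint ψ x = Nonzero x × SemiEigen ψ x

  semiEigen? : (ψ : V N → V N) → ∀ x → Dec (SemiEigen ψ x)
  semiEigen? ψ x = ∃ᶠ? λ c → ¬? (c ≟ 0F) ×-dec Fin.all? λ i → ψ x i ≟ c *F σ (x i)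

  semiEigen-cong : {ψ : V N → V N} → Linear ψ → {x y : V N} → x ≋ y → SemiEigen ψ x → SemiEigen ψ y
  semiEigen-cong ψ-linear x≋y (c , c≢0 , ψx≋cσx) =
    c , c≢0 , λ i → trans (Linear.≋-cong ψ-linear (≋-sym x≋y) i) (trans (ψx≋cσx i) (cong (λ t → c *F σ t) (x≋y i)))

  semiEigen-scale : {ψ : V N → V N} → Linear ψ → ∀ {t x} → t ≢ 0F → SemiEigen ψ x → SemiEigen ψ (t · x)
  semiEigen-scale {ψ = ψ} ψ-linear {t} {x} t≢0 (c , c≢0 , ψx≋cσx) =
    c′ , x*y≢0 (x*y≢0 t≢0 c≢0) (x⁻¹≢0 (σ≢0 t≢0)) , λ i → begin
      ψ (t · x) i               ≡⟨ Linear.·-homo ψ-linear t x i ⟩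
      t *F ψ x i                ≡⟨ cong (t *F_) (ψx≋cσx i) ⟩
      t *F (c *F σ (x i))       ≡⟨ *-assoc t c _ ⟨
      t *F c *F σ (x i)         ≡⟨ cong (_*F σ (x i)) (x*y⁻¹*y≡x (t *F c) (σ≢0 t≢0)) ⟨
      c′ *F σ t *F σ (x i)      ≡⟨ *-assoc c′ (σ t) (σ (x i)) ⟩
      c′ *F (σ t *F σ (x i))    ≡⟨ cong (c′ *F_) (σ-* t (x i)) ⟨
      c′ *F σ (t *F x i)        ∎
    where
    c′ = t *F c *F σ t ⁻¹F

  semiEigen-ker : {ψ : V N → V N} {x : V N} → SemiEigen ψ x → ψ x ≋ 0ᵛ → x ≋ 0ᵛ
  semiEigen-ker (c , c≢0 , ψx≋cσx) ψx≋0 i =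
    σ-injective (trans (x*y≡0⇒y≡0 c≢0 (trans (sym (ψx≋cσx i)) (ψx≋0 i))) (sym σ-0))

  eigenPoint? : {ψ : V N → V N} → Linear ψ → Dec (∃ (EigenPoint ψ))
  eigenPoint? {ψ = ψ} ψ-linear =
    ∃ᵛ? (λ x≋y (x≢0 , e) → x≢0 ∘ ≋-trans x≋y , semiEigen-cong ψ-linear x≋y e) (λ x → nonzero? x ×-dec semiEigen? ψ x)

  module Reduction {N r : ℕ} {ψ : V (suc N) → V (suc N)} {ρ : V (suc N) → V (suc r)}
                   (ψ-linear : Linear ψ) (ρ-linear : Linear ρ) (ker⊆ : Ker ρ ⊆ Ker ψ)
                   {v : V (suc N)} (v≢0 : Nonzero v) {a : F} (a≢0 : a ≢ 0F) (ψv≋aσv : ψ v ≋ a · σ⃗ v) where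

    private
      module Ψ = Linear ψ-linear

    k : Fin (suc N)
    k = proj₁ (nonzero-coordinate v≢0)

    vₖ≢0 : v k ≢ 0F
    vₖ≢0 = proj₂ (nonzero-coordinate v≢0)

    π π′ : V (suc N) → V N
    π  = project v k
    π′ = project (σ⃗ v) k

    private
      module Π  = Linear (project-linear v k)
      module Π′ = Linear (project-linear (σ⃗ v) k)
      module E  = Linear (embed-linear {N} k)

    -- Images are projected from σ⃗ v rather than v because eigenpoints satisfy ψ x ∈ F · σ⃗ x.
    ψ̄ : V N → V N
    ψ̄ = π′ ∘ ψ ∘ embed k

    ψ̄-linear : Linear ψ̄
    ψ̄-linear = ∘-linear (embed-linear k) (∘-linear ψ-linear (project-linear (σ⃗ v) k))

    ρv≢0 : Nonzero (ρ v)
    ρv≢0 ρv≋0 = v≢0 (semiEigen-ker {ψ = ψ} (a , a≢0 , ψv≋aσv) (ker⊆ ρv≋0))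

    k′ : Fin (suc r)
    k′ = proj₁ (nonzero-coordinate ρv≢0)

    ρ̄ : V N → V r
    ρ̄ = project (ρ v) k′ ∘ ρ ∘ embed k

    ρ̄-linear : Linear ρ̄
    ρ̄-linear = ∘-linear (embed-linear k) (∘-linear ρ-linear (project-linear (ρ v) k′))

    π′ψv≋0 : π′ (ψ v) ≋ 0ᵛ
    π′ψv≋0 j = begin
      π′ (ψ v) j          ≡⟨ Π′.≋-cong ψv≋aσv j ⟩
      π′ (a · σ⃗ v) j      ≡⟨ Π′.·-homo a (σ⃗ v) j ⟩
      a *F π′ (σ⃗ v) j     ≡⟨ cong (a *F_) (project-self (σ⃗ v) k j) ⟩
      a *F 0F             ≡⟨ zeroʳ a ⟩
      0F                  ∎

    reduced-ker : Ker ρ̄ ⊆ Ker ψ̄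
    reduced-ker {x} ρ̄x≋0 j = x*y≡0⇒y≡0 (proj₂ (nonzero-coordinate ρv≢0)) (begin
      ρ v k′ *F π′ (ψ y) j    ≡⟨ Π′.·-homo (ρ v k′) (ψ y) j ⟨
      π′ (ρ v k′ · ψ y) j     ≡⟨ Π′.≋-cong (ker⊆-combination ρ-linear ψ-linear ker⊆ _ y _ v ρ-proportional) j ⟩
      π′ (ρ y k′ · ψ v) j     ≡⟨ Π′.·-homo (ρ y k′) (ψ v) j ⟩
      ρ y k′ *F π′ (ψ v) j    ≡⟨ cong (ρ y k′ *F_) (π′ψv≋0 j) ⟩
      ρ y k′ *F 0F            ≡⟨ zeroʳ _ ⟩
      0F                      ∎)
      where
      y = embed k x
      ρ-proportional : ρ v k′ · ρ y ≋ ρ y k′ · ρ v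
      ρ-proportional = project≋0 (ρ v) k′ ρ̄x≋0

    ψ̄∘π : ∀ x → ψ̄ (π x) ≋ v k · π′ (ψ x)
    ψ̄∘π x j = begin
      π′ (ψ (embed k (π x))) j                  ≡⟨ Π′.≋-cong (Ψ.≋-cong (embed-project v k x)) j ⟩
      π′ (ψ (v k · x -ᵛ x k · v)) j             ≡⟨ Π′.≋-cong (Ψ.·-‿·-homo (v k) x (x k) v) j ⟩
      π′ (v k · ψ x -ᵛ x k · ψ v) j             ≡⟨ Π′.·-‿·-homo (v k) (ψ x) (x k) (ψ v) j ⟩
      v k *F π′ (ψ x) j - x k *F π′ (ψ v) j     ≡⟨ cong (λ t → v k *F π′ (ψ x) j - x k *F t) (π′ψv≋0 j) ⟩
      v k *F π′ (ψ x) j - x k *F 0F             ≡⟨ cong (v k *F π′ (ψ x) j -_) (zeroʳ (x k)) ⟩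
      v k *F π′ (ψ x) j - 0F                    ≡⟨ x-0≡x _ ⟩
      v k *F π′ (ψ x) j                         ∎

    π′-semiEigen : ∀ {x c} → ψ x ≋ c · σ⃗ x → π′ (ψ x) ≋ c · σ⃗ (π x)
    π′-semiEigen {x} {c} ψx≋cσx j = begin
      π′ (ψ x) j            ≡⟨ Π′.≋-cong ψx≋cσx j ⟩
      π′ (c · σ⃗ x) j        ≡⟨ Π′.·-homo c (σ⃗ x) j ⟩
      c *F π′ (σ⃗ x) j       ≡⟨ cong (c *F_) (σ⃗-project v k x j) ⟨
      c *F σ (π x j)        ∎

    π-eigenPoint : ∀ {x} → EigenPoint ψ x → Nonzero (π x) → EigenPoint ψ̄ (π x)
    π-eigenPoint {x} (_ , c , c≢0 , ψx≋cσx) πx≢0 =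
      πx≢0 , v k *F c , x*y≢0 vₖ≢0 c≢0 ,
      λ j → trans (ψ̄∘π x j) (trans (cong (v k *F_) (π′-semiEigen ψx≋cσx j)) (sym (*-assoc (v k) c _)))

    π≋0⇒∼v : ∀ {x} → Nonzero x → π x ≋ 0ᵛ → x ∼ v
    π≋0⇒∼v {x} x≢0 πx≋0 = scaled-∼ vₖ≢0 xₖ≢0 vₖx≋xₖv
      where
      vₖx≋xₖv : v k · x ≋ x k · v
      vₖx≋xₖv = project≋0 v k πx≋0
      xₖ≢0 : x k ≢ 0F
      xₖ≢0 xₖ≡0 = x≢0 λ i → x*y≡0⇒y≡0 vₖ≢0 (trans (vₖx≋xₖv i) (trans (cong (_*F v i) xₖ≡0) (zeroˡ (v i))))

    OnLine : V N → F → Set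
    OnLine w l = SemiEigen ψ (embed k w +ᵛ l · v)

    onLine-project : ∀ {w l c} → ψ (embed k w +ᵛ l · v) ≋ c · σ⃗ (embed k w +ᵛ l · v) →
                     π′ (ψ (embed k w)) ≋ c · σ⃗ (v k · w)
    onLine-project {w} {l} {c} ψz≋cσz j = begin
      π′ (ψ (embed k w)) j     ≡⟨ Linear.+·-kernel (∘-linear ψ-linear (project-linear (σ⃗ v) k)) (embed k w) l π′ψv≋0 j ⟨
      π′ (ψ z) j               ≡⟨ π′-semiEigen ψz≋cσz j ⟩
      c *F σ (π z j)           ≡⟨ cong (λ t → c *F σ t) (πz≋vₖw j) ⟩
      c *F σ (v k *F w j)      ∎
      where
      z = embed k w +ᵛ l · v
      πz≋vₖw : π z ≋ v k · w
      πz≋vₖw = ≋-trans (Π.+·-kernel (embed k w) l {v} (project-self v k)) (project-embed v k w)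

    onLine-differences : ∀ {w l l′ c c′} → Nonzero w →
                         ψ (embed k w +ᵛ l · v) ≋ c · σ⃗ (embed k w +ᵛ l · v) →
                         ψ (embed k w +ᵛ l′ · v) ≋ c′ · σ⃗ (embed k w +ᵛ l′ · v) →
                         (l - l′) *F a ≡ c′ *F σ (l - l′)
    onLine-differences {w} {l} {l′} {c} {c′} w≢0 ψz≋cσz ψz′≋c′σz′ = *-cancelʳ (σ (v k)) (σ≢0 vₖ≢0) (begin
      (l - l′) *F a *F σ (v k)            ≡⟨ *-assoc _ a _ ⟩
      (l - l′) *F (a *F σ (v k))          ≡⟨ cong ((l - l′) *F_) (ψv≋aσv k) ⟨
      (l - l′) *F ψ v k                   ≡⟨ Ψ.·-homo (l - l′) v k ⟨
      ψ ((l - l′) · v) k                  ≡⟨ Ψ.≋-cong z-z′ k ⟨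
      ψ (z -ᵛ z′) k                       ≡⟨ Ψ.-‿homo z z′ k ⟩
      ψ z k - ψ z′ k                      ≡⟨ cong₂ _-_ (ψz≋cσz k) (ψz′≋c′σz′ k) ⟩
      c *F σ (z k) - c′ *F σ (z′ k)       ≡⟨ cong (λ t → t *F σ (z k) - c′ *F σ (z′ k)) c≡c′ ⟩
      c′ *F σ (z k) - c′ *F σ (z′ k)      ≡⟨ x[y-z]≈xy-xz c′ _ _ ⟨
      c′ *F (σ (z k) - σ (z′ k))          ≡⟨ cong (c′ *F_) (σ-sub (z k) (z′ k)) ⟨
      c′ *F σ (z k - z′ k)                ≡⟨ cong (λ t → c′ *F σ t) (z-z′ k) ⟩
      c′ *F σ ((l - l′) *F v k)           ≡⟨ cong (c′ *F_) (σ-* _ _) ⟩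
      c′ *F (σ (l - l′) *F σ (v k))       ≡⟨ *-assoc c′ _ _ ⟨
      c′ *F σ (l - l′) *F σ (v k)         ∎)
      where
      z  = embed k w +ᵛ l · v
      z′ = embed k w +ᵛ l′ · v
      z-z′ : z -ᵛ z′ ≋ (l - l′) · v
      z-z′ = [x+l·v]-[x+l′·v]≋[l-l′]·v (embed k w) l l′ v
      c≡c′ : c ≡ c′
      c≡c′ = let j , wⱼ≢0 = nonzero-coordinate w≢0 in
        *-cancelʳ (σ (v k *F w j)) (σ≢0 (x*y≢0 vₖ≢0 wⱼ≢0))
                  (trans (sym (onLine-project ψz≋cσz j)) (onLine-project ψz′≋c′σz′ j))

    onLine-collinear : ∀ {w} → Nonzero w → ∀ {l₀} → OnLine w l₀ →
                       ∃ λ c → c ≢ 0F × ∀ {l} → OnLine w l → (l - l₀) *F a ≡ c *F σ (l - l₀)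
    onLine-collinear w≢0 (c₀ , c₀≢0 , ψz₀≋c₀σz₀) =
      c₀ , c₀≢0 , λ (_ , _ , ψz≋cσz) → onLine-differences w≢0 ψz≋cσz ψz₀≋c₀σz₀

    lineCoordinate : V N → F → Fin s
    lineCoordinate w = LineCoordinate.coordinate (OnLine w) (λ l → semiEigen? ψ (embed k w +ᵛ l · v))

    module Fibre (x : V (suc N)) (πx≢0 : Nonzero (π x)) where

      -- canonical makes base depend only on the point [π x], so that points x, y in one
      -- fibre get literally the same lineCoordinate function.
      base : V N
      base = canonical (proj₁ (normalize (π x) πx≢0))

      base-normalized : Normalized (proj₁ (normalize (π x) πx≢0))
      base-normalized = proj₁ (proj₂ (normalize (π x) πx≢0))

      π∼normalized : π x ∼ proj₁ (normalize (π x) πx≢0)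
      π∼normalized = proj₂ (proj₂ (normalize (π x) πx≢0))

      π∼base : π x ∼ base
      π∼base = ∼-trans π∼normalized (≋⇒∼ (≋-sym (canonical-≋ _)))

      κ : F
      κ = proj₁ π∼base

      parameter : F
      parameter = κ ⁻¹F *F x k

      line : V (suc N)
      line = embed k base +ᵛ parameter · v

      κ-line : κ · line ≋ v k · x
      κ-line i = begin
        κ *F (embed k base i +F parameter *F v i)               ≡⟨ distribˡ κ _ _ ⟩
        κ *F embed k base i +F κ *F (parameter *F v i)          ≡⟨ cong₂ _+F_ κ-embed (sym (*-assoc κ parameter (v i))) ⟩
        (v k *F x i - x k *F v i) +F κ *F parameter *F v i      ≡⟨ cong (λ t → (v k *F x i - x k *F v i) +F t *F v i) (x*[x⁻¹*y]≡y (x k) κ≢0) ⟩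
        (v k *F x i - x k *F v i) +F x k *F v i                 ≡⟨ //-rightDividesˡ (x k *F v i) (v k *F x i) ⟩
        v k *F x i                                              ∎
        where
        κ≢0 = proj₁ (proj₂ π∼base)
        κ-embed : κ *F embed k base i ≡ v k *F x i - x k *F v i
        κ-embed = trans (sym (E.·-homo κ base i))
                        (trans (E.≋-cong (≋-sym (proj₂ (proj₂ π∼base))) i) (embed-project v k x i))

      x∼line : x ∼ line
      x∼line = scaled-∼ vₖ≢0 (proj₁ (proj₂ π∼base)) (≋-sym κ-line)

      base-nonzero : Nonzero base
      base-nonzero = nonzero-∼ π∼base πx≢0

      parameter-onLine : SemiEigen ψ x → OnLine base parameter
      parameter-onLine x-eigen =
        let μ , μ≢0 , line≋μx = ∼-sym x∼line
        in semiEigen-cong ψ-linear (≋-sym line≋μx) (semiEigen-scale ψ-linear μ≢0 x-eigen)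

    fibreCoordinate : ∀ x → EigenPoint ψ x × Nonzero (π x) → Fin s
    fibreCoordinate x (_ , πx≢0) = lineCoordinate base parameter
      where open Fibre x πx≢0

    fibreCoordinate-injective : ∀ {x y} (px : EigenPoint ψ x × Nonzero (π x)) (py : EigenPoint ψ y × Nonzero (π y)) →
                                π x ∼ π y → fibreCoordinate x px ≡ fibreCoordinate y py → x ∼ y
    fibreCoordinate-injective {x} {y} (x-eigen , πx≢0) (y-eigen , πy≢0) πx∼πy e =
      ∼-trans X.x∼line (∼-trans (≋⇒∼ same-line) (∼-sym Y.x∼line))
      where
      module X = Fibre x πx≢0
      module Y = Fibre y πy≢0
      base≡ : X.base ≡ Y.base
      base≡ = canonical-cong (normalized-unique X.base-normalized Y.base-normalized
                                                (∼-trans (∼-sym X.π∼normalized) (∼-trans πx∼πy Y.π∼normalized)))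
      parameter≡ : X.parameter ≡ Y.parameter
      parameter≡ = LineCoordinate.coordinate-injective (OnLine X.base) _ (onLine-collinear X.base-nonzero)
                     (X.parameter-onLine (proj₂ x-eigen))
                     (subst (λ w → OnLine w Y.parameter) (sym base≡) (Y.parameter-onLine (proj₂ y-eigen)))
                     (trans e (cong (λ w → lineCoordinate w Y.parameter) (sym base≡)))
      same-line : X.line ≋ Y.line
      same-line i = cong₂ (λ w l → embed k w i +F l *F v i) base≡ parameter≡

    atMost : AtMostPoints b (EigenPoint ψ̄) → AtMostPoints (suc (b * s)) (EigenPoint ψ)
    atMost A = atMost-∪ (atMost-point v)
                        (atMost-fibred π (λ (x-eigen , πx≢0) → π-eigenPoint x-eigen πx≢0) A
                                       fibreCoordinate fibreCoordinate-injective)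
                        split
      where
      split : EigenPoint ψ ⊆ (_∼ v) ∪ (λ x → EigenPoint ψ x × Nonzero (π x))
      split {x} x-eigen with nonzero? (π x)
      ... | yes πx≢0 = inj₂ (x-eigen , πx≢0)
      ... | no ¬πx≢0 = inj₁ (π≋0⇒∼v (proj₁ x-eigen) (¬nonzero⇒≋0 ¬πx≢0))

  eigenPoints-atMost : ∀ r {N} {ψ : V N → V N} {ρ : V N → V r} → Linear ψ → Linear ρ → Ker ρ ⊆ Ker ψ →
                       AtMostPoints (geom s r) (EigenPoint ψ)
  eigenPoints-atMost zero {ψ = ψ} _ _ ker⊆ = atMost-empty λ x (x≢0 , x-eigen) → x≢0 (semiEigen-ker {ψ = ψ} x-eigen (ker⊆ λ ()))
  eigenPoints-atMost (suc r) {zero} _ _ _ = atMost-empty λ x (x≢0 , _) → x≢0 λ ()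
  eigenPoints-atMost (suc r) {suc N} {ψ} ψ-linear ρ-linear ker⊆ with eigenPoint? ψ-linear
  ... | no none = atMost-empty λ x x-eigen → none (x , x-eigen)
  ... | yes (v , v≢0 , a , a≢0 , ψv≋aσv) =
    subst (λ b → AtMostPoints b (EigenPoint ψ)) (sym (geom-suc s r))
          (R.atMost (eigenPoints-atMost r R.ψ̄-linear R.ρ̄-linear R.reduced-ker))
    where
    module R = Reduction ψ-linear ρ-linear ker⊆ v≢0 a≢0 ψv≋aσv

  semilinCond-split : ∀ {n r} (M : Mat n) (f : Fin r → Fin (suc n)) →
                      (λ ξ → Nonzero ξ × SemilinCond σ M ξ) ⊆
                      (λ ξ → Nonzero ξ × Annihilates (col M ∘ f) ξ) ∪ EigenPoint (rowTimes M)
  semilinCond-split M f {ξ} (ξ≢0 , c , ξM≡cσξ) with c ≟ 0F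
  ... | yes c≡0 = inj₁ (ξ≢0 , λ a → trans (rowTimes≡⋆ M ξ (f a)) (trans (ξM≡cσξ (f a)) (trans (cong (_*F _) c≡0) (zeroˡ _))))
  ... | no c≢0  = inj₂ (ξ≢0 , c , c≢0 , λ j → trans (rowTimes≡⋆ M ξ j) (ξM≡cσξ j))

theorem3p10 : (q : ℕ) → IsPrimePower q → (𝔽 : FiniteField q) → (n : ℕ) → 1 ≤ n
    → (σ : FiniteField.F 𝔽 → FiniteField.F 𝔽) → LinAlg.IsAutomorphism 𝔽 σ
    → (∃[ x ] σ x ≢ x)
    → (s : ℕ) → Count (λ x → σ x ≡ x) (FiniteField.elems 𝔽) s
    → (r : ℕ) → 1 ≤ r → r ≤ suc n
    → (M : LinAlg.Mat 𝔽 n) → LinAlg.HasRank 𝔽 M r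
    → (t : ℕ) → LinAlg.Theta 𝔽 σ M t
    → t ≤ mBound q s n r
theorem3p10 q _ 𝔽 n _ σ σ-automorphism _ s fixed-count r _ _ M ((f , f-independent) , maximal) t θ =
  count≤ θ (atMost-∪ (annihilator-atMost r (col M ∘ f) (linIndep⇒independent f-independent))
                     (eigenPoints-atMost r (rowTimes-linear M) (dots-linear (col M ∘ f))
                                         (λ {ξ} → kernel-inclusion M f f-independent maximal {ξ}))
                     (semilinCond-split M f))
  where
  open LinAlg 𝔽 using (col)
  open Vectors 𝔽 using (dots-linear)
  open Points 𝔽 using (count≤; atMost-∪)
  open Annihilators 𝔽 using (annihilator-atMost)
  open Matrices 𝔽 using (rowTimes-linear; linIndep⇒independent; kernel-inclusion)
  open SemilinearPoints 𝔽 σ σ-automorphism fixed-count using (eigenPoints-atMost; semilinCond-split)
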